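{- Every hanging-square graph $H$ on $n$ vertices has a decomposition into at most $\lceil n/2\rceil$ paths (i.e., hanging-square graphs satisfy Gallai's conjecture).
   Context: All graphs are finite and simple. The length of a path or cycle is its number of edges; a $k$-path is a path with $k$ edges; a square is a cycle of length $4$. A decomposition of a graph is a collection of subgraphs such that each edge lies in exactly one of them. Skeleton: a tree $T$ is a skeleton if there exist a coloring $\lambda:V(T)\to\{\text{black},\text{red}\}$, trees $T_0,\dots,T_t$ ($t\ge 0$) and paths $P_1,\dots,P_t$ such that: $T_0=x_0x_1x_2x_3$ is a $3$-path with $x_0,x_3$ black and $x_1,x_2$ red; $T_t=T$; each $P_i=x_0x_1\cdots x_k$ has $k\in\{4,6\}$, and $T_i$ is obtained from $T_{i-1}$ by adding $P_i$ so that its middle vertex $x_{k/2}$ (the joint of $P_i$) is identified with a vertex of $T_{i-1}$ (and $P_i$ is otherwise disjoint from $T_{i-1}$); in $P_i$ the vertices $x_0,x_k$ are black, $x_1,x_{k-1}$ are red, if $k=4$ then $x_2$ is red, and if $k=6$ then $x_3$ is black and $x_2,x_4$ are red. A brrb-path of $T$ is a $3$-path $y_0y_1y_2y_3$ in $T$ with $y_0,y_3$ black and $y_1,y_2$ red. Bunch: for $k\ge1$, a bunch of $k$ squares is the union of $k$ pairwise edge-disjoint squares $Q_1,\dots,Q_k$ for which there are two vertices $a,b$, non-adjacent in each $Q_i$, with $V(Q_i)\cap V(Q_j)=\{a,b\}$ for $i\ne j$; $a,b$ are the joints of the bunch (if $k=1$, one of the two pairs of opposite vertices is designated as the joints). Hanging-square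 graph: a graph $H$ is a hanging-square graph if $H$ is the union of a skeleton $T_H$ and a set $\mathcal{B}$ of bunches, edge-disjoint from $T_H$, no two of which have the same pair of joints, such that: (i) each $B\in\mathcal{B}$ has at least one joint identified with a vertex of $T_H$ and meets $T_H$ only in joints ($B$ is a 1-bunch if exactly one joint is in $T_H$, a 2-bunch if both are), and if $B\ne B'\in\mathcal{B}$ share vertices then $V(B)\cap V(B')\subseteq V(T_H)$; (ii) for each 2-bunch $B$ there is a brrb-path $P_B=x_0x_1x_2x_3$ of $T_H$ such that the joints of $B$ are either $x_0,x_2$ or $x_1,x_3$ ($P_B$ is occupied by $B$ at these vertices), and distinct 2-bunches give distinct brrb-paths; (iii) if $P_B=x_0x_1x_2x_3$ is occupied at $x_0,x_2$, then $d_H(x_1)=2$ and, with $H'$ the graph obtained from $H$ by deleting $E(B)$ and then isolated vertices, exactly one of: (1) $d_{H'}(x_0)\ge1$, $d_{H'}(x_2)=2$, $d_{H'}(x_3)\ge1$; (2) $d_{H'}(x_0)=1$, $d_{H'}(x_2)>2$, $d_{H'}(x_3)\ge1$; symmetrically (reading the path as $x_3x_2x_1x_0$) if $P_B$ is occupied at $x_1,x_3$. -}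

module Defs where

open import Data.Nat.Base using (ℕ; zero; suc; _+_; _≤_; _<_; _≥_; _>_; ⌈_/2⌉)
open import Data.Fin.Base using (Fin)
open import Data.Fin.Properties using (_≟_)
open import Data.Bool.Base using (Bool; true; false; _∧_; _∨_; not)
open import Data.List.Base using (List; []; _∷_; length; allFin; concatMap)
open import Data.Bool.ListAction using (any)
open import Data.List.Membership.Propositional using (_∈_; _∉_)
open import Data.List.Relation.Unary.All using (All)
open import Data.List.Relation.Unary.Linked using (Linked)
open import Data.List.Relation.Unary.Unique.Propositional using (Unique)
open import Data.Product.Base using (Σ; ∃; ∃-syntax; _×_; _,_)
open import Data.Sum.Base using (_⊎_)
open import Relation.Nullary.Negation.Core using (¬_)
open import Relation.Nullary.Decidable.Core using (⌊_⌋)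
open import Relation.Binary.PropositionalEquality.Core using (_≡_; _≢_)

record SimpleGraph (n : ℕ) : Set where
  field
    adj    : Fin n → Fin n → Bool
    sym    : ∀ u v → adj u v ≡ adj v u
    irrefl : ∀ v → adj v v ≡ false
open SimpleGraph public

module _ {n : ℕ} where

  _=ᵇ_ : Fin n → Fin n → Bool
  x =ᵇ y = ⌊ x ≟ y ⌋

  sameEdgeᵇ : Fin n → Fin n → Fin n → Fin n → Bool
  sameEdgeᵇ u v x y = ((u =ᵇ x) ∧ (v =ᵇ y)) ∨ ((u =ᵇ y) ∧ (v =ᵇ x))

countTrue : {A : Set} → (A → Bool) → List A → ℕ
countTrue p []       = 0
countTrue p (x ∷ xs) with p x
... | true  = suc (countTrue p xs)
... | false = countTrue p xs

degreeᵇ : {n : ℕ} → (Fin n → Fin n → Bool) → Fin n → ℕ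
degreeᵇ {n} a v = countTrue (a v) (allFin n)

degree : {n : ℕ} → SimpleGraph n → Fin n → ℕ
degree G v = degreeᵇ (adj G) v

record IsPathIn {n : ℕ} (G : SimpleGraph n) (p : List (Fin n)) : Set where
  field
    distinct : Unique p
    nontriv  : 2 ≤ length p
    edges    : Linked (λ u v → adj G u v ≡ true) p

pathEdgeᵇ : {n : ℕ} → List (Fin n) → Fin n → Fin n → Bool
pathEdgeᵇ []           u v = false
pathEdgeᵇ (x ∷ [])     u v = false
pathEdgeᵇ (x ∷ y ∷ ps) u v = sameEdgeᵇ u v x y ∨ pathEdgeᵇ (y ∷ ps) u v

IsPathDecomposition : {n : ℕ} → SimpleGraph n → List (List (Fin n)) → Set
IsPathDecomposition {n} G ps =
  All (IsPathIn G) ps ×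
  (∀ u v → adj G u v ≡ true → countTrue (λ p → pathEdgeᵇ p u v) ps ≡ 1)

data Color : Set where
  black red : Color

-- Skel col V E : the tree with vertex list V and edge list E is obtained by
-- the skeleton construction (T_0, then adding paths P_i of length 4 or 6
-- through their middle vertex), with colouring col (restricted to V).
data Skel {n : ℕ} (col : Fin n → Color) : List (Fin n) → List (Fin n × Fin n) → Set where
  base : ∀ x0 x1 x2 x3 →
         Unique (x0 ∷ x1 ∷ x2 ∷ x3 ∷ []) →
         col x0 ≡ black → col x1 ≡ red → col x2 ≡ red → col x3 ≡ black →
         Skel col (x0 ∷ x1 ∷ x2 ∷ x3 ∷ [])
                  ((x0 , x1) ∷ (x1 , x2) ∷ (x2 , x3) ∷ [])
  add4 : ∀ {V E} → Skel col V E → ∀ x0 x1 x2 x3 x4 →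
         x2 ∈ V →
         Unique (x0 ∷ x1 ∷ x3 ∷ x4 ∷ []) →
         All (_∉ V) (x0 ∷ x1 ∷ x3 ∷ x4 ∷ []) →
         col x0 ≡ black → col x1 ≡ red → col x2 ≡ red →
         col x3 ≡ red → col x4 ≡ black →
         Skel col (x0 ∷ x1 ∷ x3 ∷ x4 ∷ V)
                  ((x0 , x1) ∷ (x1 , x2) ∷ (x2 , x3) ∷ (x3 , x4) ∷ E)
  add6 : ∀ {V E} → Skel col V E → ∀ x0 x1 x2 x3 x4 x5 x6 →
         x3 ∈ V →
         Unique (x0 ∷ x1 ∷ x2 ∷ x4 ∷ x5 ∷ x6 ∷ []) →
         All (_∉ V) (x0 ∷ x1 ∷ x2 ∷ x4 ∷ x5 ∷ x6 ∷ []) →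
         col x0 ≡ black → col x1 ≡ red → col x2 ≡ red → col x3 ≡ black →
         col x4 ≡ red → col x5 ≡ red → col x6 ≡ black →
         Skel col (x0 ∷ x1 ∷ x2 ∷ x4 ∷ x5 ∷ x6 ∷ V)
                  ((x0 , x1) ∷ (x1 , x2) ∷ (x2 , x3) ∷ (x3 , x4) ∷ (x4 , x5) ∷ (x5 , x6) ∷ E)

treeEdgeᵇ : {n : ℕ} → List (Fin n × Fin n) → Fin n → Fin n → Bool
treeEdgeᵇ E u v = any (λ { (x , y) → sameEdgeᵇ u v x y }) E

-- 3-paths as vertex quadruples
Quad : ℕ → Set
Quad n = Fin n × Fin n × Fin n × Fin n

reverseQ : {n : ℕ} → Quad n → Quad n
reverseQ (x0 , x1 , x2 , x3) = (x3 , x2 , x1 , x0)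

IsBRRB : {n : ℕ} → (Fin n → Color) → List (Fin n × Fin n) → Quad n → Set
IsBRRB col E (y0 , y1 , y2 , y3) =
  Unique (y0 ∷ y1 ∷ y2 ∷ y3 ∷ []) ×
  treeEdgeᵇ E y0 y1 ≡ true × treeEdgeᵇ E y1 y2 ≡ true × treeEdgeᵇ E y2 y3 ≡ true ×
  col y0 ≡ black × col y1 ≡ red × col y2 ≡ red × col y3 ≡ black

-- joints ja, jb and squares Q_i = ja c_i jb d_i ja given by the list of
-- pairs (c_i , d_i); at least one square; any two squares meet exactly
-- in {ja, jb} (all listed vertices are pairwise distinct).
record Bunch (n : ℕ) : Set where
  field
    ja jb    : Fin n
    squares  : List (Fin n × Fin n)
    nonempty : 1 ≤ length squares
open Bunch public

innerVerts : {n : ℕ} → Bunch n → List (Fin n)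
innerVerts B = concatMap (λ { (c , d) → c ∷ d ∷ [] }) (squares B)

bunchVerts : {n : ℕ} → Bunch n → List (Fin n)
bunchVerts B = ja B ∷ jb B ∷ innerVerts B

WellFormedBunch : {n : ℕ} → Bunch n → Set
WellFormedBunch B = Unique (bunchVerts B)

bunchEdgeᵇ : {n : ℕ} → Bunch n → Fin n → Fin n → Bool
bunchEdgeᵇ B u v = any (λ { (c , d) →
     sameEdgeᵇ u v (ja B) c ∨ sameEdgeᵇ u v c (jb B) ∨
     sameEdgeᵇ u v (jb B) d ∨ sameEdgeᵇ u v d (ja B) }) (squares B)

JointsAre : {n : ℕ} → Bunch n → Fin n → Fin n → Set
JointsAre B x y = (ja B ≡ x × jb B ≡ y) ⊎ (ja B ≡ y × jb B ≡ x)

degreeMinus : {n : ℕ} → SimpleGraph n → Bunch n → Fin n → ℕ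
degreeMinus H B v = degreeᵇ (λ x u → adj H x u ∧ not (bunchEdgeᵇ B x u)) v

-- condition (iii) for the brrb-path x0x1x2x3 occupied by B at x0, x2
OccupiedOK : {n : ℕ} → SimpleGraph n → Bunch n → Quad n → Set
OccupiedOK H B (x0 , x1 , x2 , x3) =
  JointsAre B x0 x2 ×
  degree H x1 ≡ 2 ×
  ( (degreeMinus H B x0 ≥ 1 × degreeMinus H B x2 ≡ 2 × degreeMinus H B x3 ≥ 1)
  ⊎ (degreeMinus H B x0 ≡ 1 × degreeMinus H B x2 > 2 × degreeMinus H B x3 ≥ 1))

IsTwoBunch : {n : ℕ} → List (Fin n) → Bunch n → Set
IsTwoBunch V B = ja B ∈ V × jb B ∈ V

record HangingSquareData {n : ℕ} (H : SimpleGraph n) : Set where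
  field
    col  : Fin n → Color
    V    : List (Fin n)
    E    : List (Fin n × Fin n)
    skel : Skel col V E
    m    : ℕ
    Bs   : Fin m → Bunch n
    wf   : ∀ i → WellFormedBunch (Bs i)
    distinctJoints : ∀ i j → i ≢ j → ¬ JointsAre (Bs i) (ja (Bs j)) (jb (Bs j))
    edgesH : ∀ u v → adj H u v ≡ (treeEdgeᵇ E u v ∨ any (λ i → bunchEdgeᵇ (Bs i) u v) (allFin m))
    vertsH : ∀ x → x ∈ V ⊎ ∃[ i ] x ∈ bunchVerts (Bs i)
    someJointInT : ∀ i → ja (Bs i) ∈ V ⊎ jb (Bs i) ∈ V
    onlyJointsInT : ∀ i → All (_∉ V) (innerVerts (Bs i))
    sharedInT : ∀ i j → i ≢ j → ∀ x → x ∈ bunchVerts (Bs i) → x ∈ bunchVerts (Bs j) → x ∈ V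
    P : Fin m → Quad n
    brrb : ∀ i → IsTwoBunch V (Bs i) → IsBRRB col E (P i)
    occupied : ∀ i → IsTwoBunch V (Bs i) →
      OccupiedOK H (Bs i) (P i) ⊎ OccupiedOK H (Bs i) (reverseQ (P i))
    distinctPaths : ∀ i j → i ≢ j → IsTwoBunch V (Bs i) → IsTwoBunch V (Bs j) →
      P i ≢ P j × P i ≢ reverseQ (P j)

IsHangingSquare : {n : ℕ} → SimpleGraph n → Set
IsHangingSquare H = HangingSquareData H

module Submission where

-- The decomposition is grown while keeping the invariant `Partial`: a
-- family of edge-disjoint paths of H and a list W of distinct vertices,
-- all lying on the paths, with 2·(number of paths) ≤ |W|.  Edges are
-- counted with multiplicities (`totalMult`), so that "every edge lies in
-- exactly one path" becomes the arithmetic fact that its multiplicity is 1.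
--   * The skeleton is cut into the paths T₀, P₁, …, P_t of its
--     construction; each Pᵢ meets the earlier tree only in its joint and
--     brings at least four new vertices (`skeletonPartial`, `addPath`).
--   * Each square j₁ c₁ j₂ c₂ of a bunch has a joint on the skeleton and
--     two inner vertices c₁ c₂ that are new; the path through that joint
--     is rerouted around the square, giving one more path for two more
--     vertices (`reroute`, `insert`, `addSquare`).
--   * At the end |W| ≤ n because W is a list of distinct vertices, and
--     every edge of H is a skeleton edge or a square edge (`complete`).

open import Defs hiding (sym)
open import Data.Nat.Base using (ℕ; zero; suc; _+_; _≤_; z≤n; s≤s; ⌈_/2⌉)
open import Data.Nat.Properties using (+-assoc; +-identityʳ; ≤-refl; ≤-trans; +-mono-≤; ≰⇒>; n≡⌈n+n/2⌉; ⌈n/2⌉-mono)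
import Data.Nat.Properties as ℕ
open import Data.Nat.Tactic.RingSolver using (solve-∀)
open import Data.Fin.Base using (Fin)
import Data.Fin.Base as Fin
open import Data.Fin.Properties using (_≟_; pigeonhole; <-irrefl)
open import Data.Bool.Base using (Bool; true; false; _∧_; _∨_; T)
open import Data.Bool.Properties using (∨-identityʳ; T-≡; T-∨; T-∧)
open import Data.List.Base using (List; []; _∷_; _++_; length; lookup; map; concatMap; allFin)
open import Data.Bool.ListAction using (any)
open import Data.List.Properties using (length-++)
open import Data.List.Membership.Propositional using (_∈_; _∉_; lose; find)
open import Data.List.Membership.Propositional.Properties using (∈-lookup; ∈-++⁻; ∈-++⁺ˡ; ∈-++⁺ʳ; ∈-∃++; ∈-map⁻; ∈-allFin)
open import Data.List.Relation.Unary.Any using (Any; here; there)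
import Data.List.Relation.Unary.Any as Any
import Data.List.Relation.Unary.Any.Properties as AnyP
open import Data.List.Relation.Unary.All using (All; []; _∷_)
open import Data.List.Relation.Unary.All.Properties using (All¬⇒¬Any; ¬Any⇒All¬)
import Data.List.Relation.Unary.All as All
import Data.List.Relation.Unary.All.Properties as AllP
open import Data.List.Relation.Unary.AllPairs using ([]; _∷_)
open import Data.List.Relation.Unary.Linked using (Linked; []; [-]; _∷_)
open import Data.List.Relation.Unary.Unique.Propositional using (Unique)
open import Data.List.Relation.Binary.Disjoint.Propositional using (Disjoint)
import Data.List.Relation.Unary.Unique.Propositional.Properties as Unique
import Data.Product.Base as Product
open import Data.Product.Base using (∃-syntax; _×_; _,_; proj₁; proj₂)
open import Data.Sum.Base using (_⊎_; inj₁; inj₂; [_,_]′)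
import Data.Sum.Base
open import Function.Base using (_∘_)
open import Function.Bundles using (Equivalence)
open import Data.Empty using (⊥; ⊥-elim)
open import Data.Unit.Base using (⊤; tt)
open import Relation.Nullary using (¬_; yes; no)
open import Relation.Nullary.Decidable using (toWitness)
open import Relation.Binary.PropositionalEquality using (_≡_; _≢_; refl; sym; trans; cong; cong₂; subst; ≢-sym; module ≡-Reasoning)
open ≡-Reasoning

bit : Bool → ℕ
bit true  = 1
bit false = 0

bit-T : ∀ b → 1 ≤ bit b → T b
bit-T true _ = tt

T-bit : ∀ {b} → T b → 1 ≤ bit b
T-bit {true} _ = ≤-refl

bit≤1 : ∀ b → bit b ≤ 1
bit≤1 true  = ≤-refl
bit≤1 false = z≤n

countTrue-∷ : {A : Set} (f : A → Bool) (x : A) (xs : List A) → countTrue f (x ∷ xs) ≡ bit (f x) + countTrue f xs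
countTrue-∷ f x xs with f x
... | true  = refl
... | false = refl

≤1-sum : {a b : ℕ} → a ≤ 1 → b ≤ 1 → (1 ≤ a → 1 ≤ b → ⊥) → a + b ≤ 1
≤1-sum z≤n       b≤1 _ = b≤1
≤1-sum (s≤s z≤n) z≤n _ = ≤-refl
≤1-sum (s≤s z≤n) (s≤s z≤n) both = ⊥-elim (both ≤-refl ≤-refl)

one-more : ∀ {a k w} → 2 ≤ k → a + a ≤ w → suc a + suc a ≤ k + w
one-more {a} {k} {w} two≤k few = subst (_≤ k + w) (sym (cong suc (ℕ.+-suc a a))) (+-mono-≤ two≤k few)

positive-sum : ∀ a {b} → 1 ≤ a + b → 1 ≤ a ⊎ 1 ≤ b
positive-sum zero    h = inj₂ h
positive-sum (suc a) h = inj₁ (s≤s z≤n)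

zero-unless-positive : ∀ {t} → (1 ≤ t → ⊥) → t ≡ 0
zero-unless-positive {zero}  _   = refl
zero-unless-positive {suc t} pos = ⊥-elim (pos (s≤s z≤n))

module _ {n : ℕ} where

  private
    Vertex = Fin n
    Pair   = Fin n × Fin n

  sameEdge-refl : (x y : Vertex) → T (sameEdgeᵇ x y x y)
  sameEdge-refl x y with x ≟ x | y ≟ y
  ... | yes _  | yes _  = tt
  ... | no x≢x | _      = ⊥-elim (x≢x refl)
  ... | yes _  | no y≢y = ⊥-elim (y≢y refl)

  sameEdge⇒ : (u v x y : Vertex) → T (sameEdgeᵇ u v x y) → (u ≡ x × v ≡ y) ⊎ (u ≡ y × v ≡ x)
  sameEdge⇒ u v x y = Data.Sum.Base.map both both ∘ Equivalence.to (T-∨ {(u =ᵇ x) ∧ (v =ᵇ y)})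
    where
    both : ∀ {a b c d : Vertex} → T ((a =ᵇ b) ∧ (c =ᵇ d)) → a ≡ b × c ≡ d
    both {a} {b} {c} {d} = Product.map (toWitness {a? = a ≟ b}) (toWitness {a? = c ≟ d}) ∘ Equivalence.to (T-∧ {a =ᵇ b})

  match : Vertex → Vertex → Vertex → Vertex → ℕ
  match u v x y = bit (sameEdgeᵇ u v x y)

  match-ends : ∀ u v x y → 1 ≤ match u v x y → (u ≡ x × v ≡ y) ⊎ (u ≡ y × v ≡ x)
  match-ends u v x y h = sameEdge⇒ u v x y (bit-T (sameEdgeᵇ u v x y) h)

  pathMult : List Vertex → Vertex → Vertex → ℕ
  pathMult []          u v = 0
  pathMult (x ∷ [])    u v = 0
  pathMult (x ∷ y ∷ p) u v = match u v x y + pathMult (y ∷ p) u v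

  edgeMult : List Pair → Vertex → Vertex → ℕ
  edgeMult []             u v = 0
  edgeMult ((x , y) ∷ Es) u v = match u v x y + edgeMult Es u v

  totalMult : List (List Vertex) → Vertex → Vertex → ℕ
  totalMult []      u v = 0
  totalMult (p ∷ D) u v = pathMult p u v + totalMult D u v

  OnPath : Vertex → List (List Vertex) → Set
  OnPath x D = Any (x ∈_) D

  pathEdges : List Vertex → List Pair
  pathEdges []          = []
  pathEdges (x ∷ [])    = []
  pathEdges (x ∷ y ∷ p) = (x , y) ∷ pathEdges (y ∷ p)

  pathMult≡edgeMult : ∀ p u v → pathMult p u v ≡ edgeMult (pathEdges p) u v
  pathMult≡edgeMult []          u v = refl
  pathMult≡edgeMult (x ∷ [])    u v = refl
  pathMult≡edgeMult (x ∷ y ∷ p) u v = cong (match u v x y +_) (pathMult≡edgeMult (y ∷ p) u v)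

  edgeMult-++ : ∀ Es Fs u v → edgeMult (Es ++ Fs) u v ≡ edgeMult Es u v + edgeMult Fs u v
  edgeMult-++ []             Fs u v = refl
  edgeMult-++ ((x , y) ∷ Es) Fs u v =
    trans (cong (match u v x y +_) (edgeMult-++ Es Fs u v)) (sym (+-assoc (match u v x y) _ _))

  pathMult-split : ∀ L a M u v → pathMult (L ++ a ∷ M) u v ≡ pathMult (L ++ a ∷ []) u v + pathMult (a ∷ M) u v
  pathMult-split []          a M u v = refl
  pathMult-split (x ∷ [])    a M u v = cong (_+ pathMult (a ∷ M) u v) (sym (+-identityʳ (match u v x a)))
  pathMult-split (x ∷ y ∷ L) a M u v =
    trans (cong (match u v x y +_) (pathMult-split (y ∷ L) a M u v)) (sym (+-assoc (match u v x y) _ _))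

  edgeMult-any : ∀ Es u v → Any (λ e → T (sameEdgeᵇ u v (proj₁ e) (proj₂ e))) Es → 1 ≤ edgeMult Es u v
  edgeMult-any ((x , y) ∷ Es) u v (here hit)  = ≤-trans (T-bit hit) (ℕ.m≤m+n (match u v x y) _)
  edgeMult-any ((x , y) ∷ Es) u v (there hits) = ≤-trans (edgeMult-any Es u v hits) (ℕ.m≤n+m _ (match u v x y))

  listed : {Es : List Pair} {x y : Vertex} → (x , y) ∈ Es → T (treeEdgeᵇ Es x y)
  listed {x = x} {y} e∈ = AnyP.any⁺ _ (lose e∈ (sameEdge-refl x y))

  pathMult-ends : ∀ p u v → 1 ≤ pathMult p u v → u ∈ p × v ∈ p
  pathMult-ends (x ∷ p@(y ∷ _)) u v h =
    [ ends-of-match ∘ match-ends u v x y , Product.map there there ∘ pathMult-ends p u v ]′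
      (positive-sum (match u v x y) h)
    where
    ends-of-match : (u ≡ x × v ≡ y) ⊎ (u ≡ y × v ≡ x) → u ∈ x ∷ p × v ∈ x ∷ p
    ends-of-match (inj₁ (refl , refl)) = here refl , there (here refl)
    ends-of-match (inj₂ (refl , refl)) = there (here refl) , here refl

  pathMult-loopless : ∀ p u v → Unique p → 1 ≤ pathMult p u v → u ≢ v
  pathMult-loopless (x ∷ p@(y ∷ _)) u v (x∉ ∷ up) h with positive-sum (match u v x y) h
  ... | inj₂ rest = pathMult-loopless p u v up rest
  ... | inj₁ hit with match-ends u v x y hit
  ...   | inj₁ (refl , refl) = All.head x∉
  ...   | inj₂ (refl , refl) = ≢-sym (All.head x∉)

  pathMult-unique : ∀ p u v → Unique p → pathMult p u v ≡ bit (pathEdgeᵇ p u v)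
  pathMult-unique []          u v _ = refl
  pathMult-unique (x ∷ [])    u v _ = refl
  pathMult-unique (x ∷ y ∷ p) u v (x∉ ∷ up) with sameEdgeᵇ u v x y in hit
  ... | false = pathMult-unique (y ∷ p) u v up
  ... | true  = cong suc (zero-unless-positive x-again)
    where
    x-again : 1 ≤ pathMult (y ∷ p) u v → ⊥
    x-again rest with sameEdge⇒ u v x y (Equivalence.from T-≡ hit) | pathMult-ends (y ∷ p) u v rest
    ... | inj₁ (refl , _) | u∈ , _ = All¬⇒¬Any x∉ u∈
    ... | inj₂ (_ , refl) | _ , v∈ = All¬⇒¬Any x∉ v∈

  pathMult≤1 : ∀ p u v → Unique p → pathMult p u v ≤ 1
  pathMult≤1 p u v up = subst (_≤ 1) (sym (pathMult-unique p u v up)) (bit≤1 (pathEdgeᵇ p u v))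

  middle-on-edges : ∀ x y z u v → 1 ≤ pathMult (x ∷ y ∷ z ∷ []) u v → u ≡ y ⊎ v ≡ y
  middle-on-edges x y z u v h with positive-sum (match u v x y) h
  ... | inj₁ hit with match-ends u v x y hit
  ...   | inj₁ (_ , v≡y) = inj₂ v≡y
  ...   | inj₂ (u≡y , _) = inj₁ u≡y
  middle-on-edges x y z u v h | inj₂ rest with match-ends u v y z (subst (1 ≤_) (+-identityʳ _) rest)
  ...   | inj₁ (u≡y , _) = inj₁ u≡y
  ...   | inj₂ (_ , v≡y) = inj₂ v≡y

  totalMult-ends : ∀ D u v → 1 ≤ totalMult D u v → OnPath u D × OnPath v D
  totalMult-ends (p ∷ D) u v h with positive-sum (pathMult p u v) h
  ... | inj₁ inP  = Product.map here here (pathMult-ends p u v inP)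
  ... | inj₂ inD = Product.map there there (totalMult-ends D u v inD)

  totalMult-off : ∀ D u v → ¬ OnPath u D ⊎ ¬ OnPath v D → 1 ≤ totalMult D u v → ⊥
  totalMult-off D u v (inj₁ u∉) h = u∉ (proj₁ (totalMult-ends D u v h))
  totalMult-off D u v (inj₂ v∉) h = v∉ (proj₂ (totalMult-ends D u v h))

  countTrue≡totalMult : ∀ D u v → All Unique D → countTrue (λ p → pathEdgeᵇ p u v) D ≡ totalMult D u v
  countTrue≡totalMult []      u v []        = refl
  countTrue≡totalMult (p ∷ D) u v (up ∷ uD) =
    trans (countTrue-∷ (λ p → pathEdgeᵇ p u v) p D)
          (cong₂ _+_ (sym (pathMult-unique p u v up)) (countTrue≡totalMult D u v uD))

  unique-length : (xs : List Vertex) → Unique xs → length xs ≤ n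
  unique-length xs uxs with length xs ℕ.≤? n
  ... | yes fits = fits
  ... | no  long with pigeonhole (≰⇒> long) (lookup xs)
  ...   | i , j , i<j , same = ⊥-elim (<-irrefl (lookup-injective xs uxs i j same) i<j)
    where
    lookup-injective : ∀ ys → Unique ys → ∀ i j → lookup ys i ≡ lookup ys j → i ≡ j
    lookup-injective (y ∷ ys) u         Fin.zero    Fin.zero    e = refl
    lookup-injective (y ∷ ys) (y∉ ∷ _)  Fin.zero    (Fin.suc j) e = ⊥-elim (All¬⇒¬Any y∉ (subst (_∈ ys) (sym e) (∈-lookup j)))
    lookup-injective (y ∷ ys) (y∉ ∷ _)  (Fin.suc i) Fin.zero    e = ⊥-elim (All¬⇒¬Any y∉ (subst (_∈ ys) e (∈-lookup i)))
    lookup-injective (y ∷ ys) (_ ∷ uys) (Fin.suc i) (Fin.suc j) e = cong Fin.suc (lookup-injective ys uys i j e)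

  unique-cons : {x : Vertex} {xs : List Vertex} → x ∉ xs → Unique xs → Unique (x ∷ xs)
  unique-cons {xs = xs} x∉ uxs = ¬Any⇒All¬ xs x∉ ∷ uxs

  unique-split : (L : List Vertex) (a : Vertex) (R : List Vertex) → Unique (L ++ a ∷ R) → Unique L × Unique (a ∷ R) × Disjoint L (a ∷ R)
  unique-split []      a R u         = [] , u , λ ()
  unique-split (x ∷ L) a R (x∉ ∷ u) with unique-split L a R u
  ... | uL , uaR , apart =
    (AllP.++⁻ˡ L x∉ ∷ uL) , uaR ,
    λ { (here refl , z∈) → All¬⇒¬Any (AllP.++⁻ʳ L x∉) z∈ ; (there z∈L , z∈) → apart (z∈L , z∈) }

  unique-insert : (L R : List Vertex) (j : Vertex) → Unique (L ++ R) → j ∉ L ++ R → Unique (L ++ j ∷ R)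
  unique-insert []      R j u         j∉ = unique-cons j∉ u
  unique-insert (x ∷ L) R j (x∉ ∷ u) j∉ =
    AllP.++⁺ (AllP.++⁻ˡ L x∉) ((λ x≡j → j∉ (here (sym x≡j))) ∷ AllP.++⁻ʳ L x∉) ∷
    unique-insert L R j u (j∉ ∘ there)

  ∈-insert⁻ : (L R : List Vertex) {j z : Vertex} → z ∈ L ++ j ∷ R → z ∈ L ++ R ⊎ z ≡ j
  ∈-insert⁻ []      R (here z≡j) = inj₂ z≡j
  ∈-insert⁻ []      R (there z∈) = inj₁ z∈
  ∈-insert⁻ (x ∷ L) R (here z≡x) = inj₁ (here z≡x)
  ∈-insert⁻ (x ∷ L) R (there z∈) = Data.Sum.Base.map₁ there (∈-insert⁻ L R z∈)

  ∈-insert⁺ : (L R : List Vertex) {j z : Vertex} → z ∈ L ++ R → z ∈ L ++ j ∷ R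
  ∈-insert⁺ L R z∈ with ∈-++⁻ L z∈
  ... | inj₁ z∈L = ∈-++⁺ˡ z∈L
  ... | inj₂ z∈R = ∈-++⁺ʳ L (there z∈R)

  length-insert : (L R : List Vertex) (j : Vertex) → length (L ++ j ∷ R) ≡ suc (length (L ++ R))
  length-insert []      R j = refl
  length-insert (x ∷ L) R j = cong suc (length-insert L R j)

  length-≥2 : (L : List Vertex) {x y : Vertex} {ys : List Vertex} → 2 ≤ length (L ++ x ∷ y ∷ ys)
  length-≥2 []      = s≤s (s≤s z≤n)
  length-≥2 (_ ∷ L) = ℕ.m≤n⇒m≤1+n (length-≥2 L)

  module _ {R : Vertex → Vertex → Set} where

    linked-split : (L : List Vertex) (a : Vertex) (M : List Vertex) → Linked R (L ++ a ∷ M) → Linked R (L ++ a ∷ []) × Linked R (a ∷ M)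
    linked-split []          a M l       = [-] , l
    linked-split (x ∷ [])    a M (r ∷ l) = (r ∷ [-]) , l
    linked-split (x ∷ y ∷ L) a M (r ∷ l) = Product.map₁ (r ∷_) (linked-split (y ∷ L) a M l)

    linked-join : (L : List Vertex) (a : Vertex) (M : List Vertex) → Linked R (L ++ a ∷ []) → Linked R (a ∷ M) → Linked R (L ++ a ∷ M)
    linked-join []          a M _        l = l
    linked-join (x ∷ [])    a M (r ∷ _)  l = r ∷ l
    linked-join (x ∷ y ∷ L) a M (r ∷ lL) l = r ∷ linked-join (y ∷ L) a M lL l

-- the 4-cycle j₁ c₁ j₂ c₂, with opposite vertices j₁ j₂ as its joints
record Square (n : ℕ) : Set where
  constructor square
  field j₁ j₂ c₁ c₂ : Fin n
open Square

module _ {n : ℕ} where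

  squareEdges : Square n → List (Fin n × Fin n)
  squareEdges (square j₁ j₂ c₁ c₂) = (j₁ , c₁) ∷ (c₁ , j₂) ∷ (j₂ , c₂) ∷ (c₂ , j₁) ∷ []

  squareVerts : Square n → List (Fin n)
  squareVerts (square j₁ j₂ c₁ c₂) = j₁ ∷ j₂ ∷ c₁ ∷ c₂ ∷ []

  swapJoints : Square n → Square n
  swapJoints (square j₁ j₂ c₁ c₂) = square j₂ j₁ c₂ c₁

  edgeMult-swapJoints : ∀ q u v → edgeMult (squareEdges (swapJoints q)) u v ≡ edgeMult (squareEdges q) u v
  edgeMult-swapJoints (square j₁ j₂ c₁ c₂) u v = rotate (match u v j₁ c₁) (match u v c₁ j₂) (match u v j₂ c₂) (match u v c₂ j₁)
    where
    rotate : ∀ a b c d → c + (d + (a + (b + 0))) ≡ a + (b + (c + (d + 0)))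
    rotate = solve-∀

  squareVerts-swapJoints : ∀ q {x} → x ∈ squareVerts (swapJoints q) → x ∈ squareVerts q
  squareVerts-swapJoints (square j₁ j₂ c₁ c₂) (here refl)                         = there (here refl)
  squareVerts-swapJoints (square j₁ j₂ c₁ c₂) (there (here refl))                 = here refl
  squareVerts-swapJoints (square j₁ j₂ c₁ c₂) (there (there (here refl)))         = there (there (there (here refl)))
  squareVerts-swapJoints (square j₁ j₂ c₁ c₂) (there (there (there (here refl)))) = there (there (here refl))

  edgeMult-square : ∀ q u v → edgeMult (squareEdges q) u v ≡
                    pathMult (j₁ q ∷ c₁ q ∷ j₂ q ∷ []) u v + pathMult (j₂ q ∷ c₂ q ∷ j₁ q ∷ []) u v
  edgeMult-square q@(square j₁ j₂ c₁ c₂) u v =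
    trans (edgeMult-++ (pathEdges (j₁ ∷ c₁ ∷ j₂ ∷ [])) (pathEdges (j₂ ∷ c₂ ∷ j₁ ∷ [])) u v)
          (sym (cong₂ _+_ (pathMult≡edgeMult (j₁ ∷ c₁ ∷ j₂ ∷ []) u v) (pathMult≡edgeMult (j₂ ∷ c₂ ∷ j₁ ∷ []) u v)))

  squareEdge-inner : ∀ q u v → 1 ≤ edgeMult (squareEdges q) u v →
                     u ∈ c₁ q ∷ c₂ q ∷ [] ⊎ v ∈ c₁ q ∷ c₂ q ∷ []
  squareEdge-inner q@(square j₁ j₂ c₁ c₂) u v h
    with positive-sum (pathMult (j₁ ∷ c₁ ∷ j₂ ∷ []) u v) (subst (1 ≤_) (edgeMult-square q u v) h)
  ... | inj₁ first  = Data.Sum.Base.map (λ { refl → here refl }) (λ { refl → here refl }) (middle-on-edges j₁ c₁ j₂ u v first)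
  ... | inj₂ second = Data.Sum.Base.map (λ { refl → there (here refl) }) (λ { refl → there (here refl) })
                                         (middle-on-edges j₂ c₂ j₁ u v second)

  -- The two ways of rerouting a path L j₁ R through a square q, used below
  -- depending on whether j₂ lies on R; either way the two new vertex
  -- sequences carry exactly the edges of the path and of q.
  throughFirst aroundFirst : Square n → List (Fin n) → List (Fin n)
  throughFirst q L = L ++ j₁ q ∷ c₁ q ∷ j₂ q ∷ c₂ q ∷ []
  aroundFirst  q L = L ++ j₁ q ∷ c₁ q ∷ []

  throughSecond aroundSecond : Square n → List (Fin n) → List (Fin n)
  throughSecond q R = c₂ q ∷ j₁ q ∷ R
  aroundSecond  q R = c₁ q ∷ j₂ q ∷ c₂ q ∷ j₁ q ∷ R

  through-mult : ∀ q L R u v → pathMult (throughFirst q L) u v + pathMult (throughSecond q R) u v ≡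
                                edgeMult (squareEdges q) u v + pathMult (L ++ j₁ q ∷ R) u v
  through-mult q@(square j₁ j₂ c₁ c₂) L R u v = begin
    pathMult (L ++ j₁ ∷ c₁ ∷ j₂ ∷ c₂ ∷ []) u v + (match u v c₂ j₁ + after)
      ≡⟨ cong (_+ pathMult (throughSecond q R) u v) (pathMult-split L j₁ (c₁ ∷ j₂ ∷ c₂ ∷ []) u v) ⟩
    (before + (match u v j₁ c₁ + (match u v c₁ j₂ + (match u v j₂ c₂ + 0)))) + (match u v c₂ j₁ + after)
      ≡⟨ regroup before after (match u v j₁ c₁) (match u v c₁ j₂) (match u v j₂ c₂) (match u v c₂ j₁) ⟩
    edgeMult (squareEdges q) u v + (before + after)
      ≡⟨ cong (edgeMult (squareEdges q) u v +_) (sym (pathMult-split L j₁ R u v)) ⟩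
    edgeMult (squareEdges q) u v + pathMult (L ++ j₁ ∷ R) u v ∎
    where
    before = pathMult (L ++ j₁ ∷ []) u v
    after  = pathMult (j₁ ∷ R) u v
    regroup : ∀ A B a b c d → (A + (a + (b + (c + 0)))) + (d + B) ≡ (a + (b + (c + (d + 0)))) + (A + B)
    regroup = solve-∀

  around-mult : ∀ q L R u v → pathMult (aroundFirst q L) u v + pathMult (aroundSecond q R) u v ≡
                               edgeMult (squareEdges q) u v + pathMult (L ++ j₁ q ∷ R) u v
  around-mult q@(square j₁ j₂ c₁ c₂) L R u v = begin
    pathMult (L ++ j₁ ∷ c₁ ∷ []) u v + (match u v c₁ j₂ + (match u v j₂ c₂ + (match u v c₂ j₁ + after)))
      ≡⟨ cong (_+ pathMult (aroundSecond q R) u v) (pathMult-split L j₁ (c₁ ∷ []) u v) ⟩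
    (before + (match u v j₁ c₁ + 0)) + (match u v c₁ j₂ + (match u v j₂ c₂ + (match u v c₂ j₁ + after)))
      ≡⟨ regroup before after (match u v j₁ c₁) (match u v c₁ j₂) (match u v j₂ c₂) (match u v c₂ j₁) ⟩
    edgeMult (squareEdges q) u v + (before + after)
      ≡⟨ cong (edgeMult (squareEdges q) u v +_) (sym (pathMult-split L j₁ R u v)) ⟩
    edgeMult (squareEdges q) u v + pathMult (L ++ j₁ ∷ R) u v ∎
    where
    before = pathMult (L ++ j₁ ∷ []) u v
    after  = pathMult (j₁ ∷ R) u v
    regroup : ∀ A B a b c d → (A + (a + 0)) + (b + (c + (d + B))) ≡ (a + (b + (c + (d + 0)))) + (A + B)
    regroup = solve-∀

  through-keeps : ∀ q L R {x} → x ∈ L ++ j₁ q ∷ R → x ∈ throughFirst q L ⊎ x ∈ throughSecond q R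
  through-keeps q L R x∈ with ∈-++⁻ L x∈
  ... | inj₁ x∈L         = inj₁ (∈-++⁺ˡ x∈L)
  ... | inj₂ (here refl) = inj₂ (there (here refl))
  ... | inj₂ (there x∈R) = inj₂ (there (there x∈R))

  around-keeps : ∀ q L R {x} → x ∈ L ++ j₁ q ∷ R → x ∈ aroundFirst q L ⊎ x ∈ aroundSecond q R
  around-keeps q L R x∈ with ∈-++⁻ L x∈
  ... | inj₁ x∈L         = inj₁ (∈-++⁺ˡ x∈L)
  ... | inj₂ (here refl) = inj₁ (∈-++⁺ʳ L (here refl))
  ... | inj₂ (there x∈R) = inj₂ (there (there (there (there x∈R))))

  through-within : ∀ q L R {x} → x ∈ throughFirst q L ⊎ x ∈ throughSecond q R → x ∈ L ++ j₁ q ∷ R ⊎ x ∈ squareVerts q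
  through-within q L R (inj₁ x∈) with ∈-++⁻ L x∈
  ... | inj₁ x∈L                                 = inj₁ (∈-++⁺ˡ x∈L)
  ... | inj₂ (here refl)                         = inj₂ (here refl)
  ... | inj₂ (there (here refl))                 = inj₂ (there (there (here refl)))
  ... | inj₂ (there (there (here refl)))         = inj₂ (there (here refl))
  ... | inj₂ (there (there (there (here refl)))) = inj₂ (there (there (there (here refl))))
  through-within q L R (inj₂ (here refl)) = inj₂ (there (there (there (here refl))))
  through-within q L R (inj₂ (there x∈))  = inj₁ (∈-++⁺ʳ L x∈)

  around-within : ∀ q L R {x} → x ∈ aroundFirst q L ⊎ x ∈ aroundSecond q R → x ∈ L ++ j₁ q ∷ R ⊎ x ∈ squareVerts q
  around-within q L R (inj₁ x∈) with ∈-++⁻ L x∈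
  ... | inj₁ x∈L                 = inj₁ (∈-++⁺ˡ x∈L)
  ... | inj₂ (here refl)         = inj₂ (here refl)
  ... | inj₂ (there (here refl)) = inj₂ (there (there (here refl)))
  around-within q L R (inj₂ (here refl))                 = inj₂ (there (there (here refl)))
  around-within q L R (inj₂ (there (here refl)))         = inj₂ (there (here refl))
  around-within q L R (inj₂ (there (there (here refl)))) = inj₂ (there (there (there (here refl))))
  around-within q L R (inj₂ (there (there (there x∈))))  = inj₁ (∈-++⁺ʳ L x∈)

  innerOf : List (Square n) → List (Fin n)
  innerOf []       = []
  innerOf (q ∷ qs) = c₁ q ∷ c₂ q ∷ innerOf qs

  withSquares : List (Square n) → List (Fin n × Fin n) → List (Fin n × Fin n)
  withSquares []       Es = Es
  withSquares (q ∷ qs) Es = squareEdges q ++ withSquares qs Es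

  innerOf-++ : ∀ qs rs → innerOf (qs ++ rs) ≡ innerOf qs ++ innerOf rs
  innerOf-++ []       rs = refl
  innerOf-++ (q ∷ qs) rs = cong (λ xs → c₁ q ∷ c₂ q ∷ xs) (innerOf-++ qs rs)

  innerOf-∈ : ∀ {q qs} → q ∈ qs → c₁ q ∈ innerOf qs × c₂ q ∈ innerOf qs
  innerOf-∈ (here refl) = here refl , there (here refl)
  innerOf-∈ (there q∈)  = Product.map (there ∘ there) (there ∘ there) (innerOf-∈ q∈)

  innerOf-distinct : ∀ {q} qs → Unique (innerOf qs) → q ∈ qs → c₁ q ≢ c₂ q
  innerOf-distinct (q ∷ qs) (c₁∉ ∷ _)      (here refl) = All.head c₁∉
  innerOf-distinct (q ∷ qs) (_ ∷ _ ∷ uqs) (there q∈)  = innerOf-distinct qs uqs q∈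

  withSquares-square : ∀ {P : Fin n × Fin n → Set} {q} qs Es → q ∈ qs →
    Any P (squareEdges q) → Any P (withSquares qs Es)
  withSquares-square (q ∷ qs) Es (here refl) hit = AnyP.++⁺ˡ hit
  withSquares-square (q ∷ qs) Es (there q∈)  hit = AnyP.++⁺ʳ (squareEdges q) (withSquares-square qs Es q∈ hit)

  withSquares-base : ∀ {P : Fin n × Fin n → Set} qs Es → Any P Es → Any P (withSquares qs Es)
  withSquares-base []       Es hit = hit
  withSquares-base (q ∷ qs) Es hit = AnyP.++⁺ʳ (squareEdges q) (withSquares-base qs Es hit)

record IsSquareIn {n : ℕ} (G : SimpleGraph n) (q : Square n) : Set where
  field
    j₁≢j₂ : j₁ q ≢ j₂ q
    j₁≢c₁ : j₁ q ≢ c₁ q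
    j₁≢c₂ : j₁ q ≢ c₂ q
    j₂≢c₁ : j₂ q ≢ c₁ q
    j₂≢c₂ : j₂ q ≢ c₂ q
    c₁≢c₂ : c₁ q ≢ c₂ q
    j₁c₁  : adj G (j₁ q) (c₁ q) ≡ true
    c₁j₂  : adj G (c₁ q) (j₂ q) ≡ true
    j₂c₂  : adj G (j₂ q) (c₂ q) ≡ true
    c₂j₁  : adj G (c₂ q) (j₁ q) ≡ true

module _ {n : ℕ} {G : SimpleGraph n} where

  swapJoints-isSquare : ∀ {q} → IsSquareIn G q → IsSquareIn G (swapJoints q)
  swapJoints-isSquare {square _ _ _ _} sq = record
    { j₁≢j₂ = ≢-sym j₁≢j₂ ; j₁≢c₁ = j₂≢c₂ ; j₁≢c₂ = j₂≢c₁ ; j₂≢c₁ = j₁≢c₂ ; j₂≢c₂ = j₁≢c₁ ; c₁≢c₂ = ≢-sym c₁≢c₂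
    ; j₁c₁ = j₂c₂ ; c₁j₂ = c₂j₁ ; j₂c₂ = j₁c₁ ; c₂j₁ = c₁j₂ }
    where open IsSquareIn sq

  squareMult≤1 : ∀ {q} → IsSquareIn G q → ∀ u v → edgeMult (squareEdges q) u v ≤ 1
  squareMult≤1 {q@(square j₁ j₂ c₁ c₂)} sq u v =
    subst (_≤ 1) (sym (edgeMult-square q u v))
      (≤1-sum (pathMult≤1 (j₁ ∷ c₁ ∷ j₂ ∷ []) u v ((j₁≢c₁ ∷ j₁≢j₂ ∷ []) ∷ (j₂≢c₁ ∘ sym ∷ []) ∷ [] ∷ []))
              (pathMult≤1 (j₂ ∷ c₂ ∷ j₁ ∷ []) u v ((j₂≢c₂ ∷ j₁≢j₂ ∘ sym ∷ []) ∷ (j₁≢c₂ ∘ sym ∷ []) ∷ [] ∷ []))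
              c₁-twice)
    where
    open IsSquareIn sq
    c₁-off : c₁ ∉ j₂ ∷ c₂ ∷ j₁ ∷ []
    c₁-off (here c₁≡j₂)                 = j₂≢c₁ (sym c₁≡j₂)
    c₁-off (there (here c₁≡c₂))         = c₁≢c₂ c₁≡c₂
    c₁-off (there (there (here c₁≡j₁))) = j₁≢c₁ (sym c₁≡j₁)
    c₁-twice : 1 ≤ pathMult (j₁ ∷ c₁ ∷ j₂ ∷ []) u v → 1 ≤ pathMult (j₂ ∷ c₂ ∷ j₁ ∷ []) u v → ⊥
    c₁-twice first second with middle-on-edges j₁ c₁ j₂ u v first | pathMult-ends (j₂ ∷ c₂ ∷ j₁ ∷ []) u v second
    ... | inj₁ refl | u∈ , _ = c₁-off u∈
    ... | inj₂ refl | _ , v∈ = c₁-off v∈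

module Decomposing {n : ℕ} (G : SimpleGraph n) where

  open import Data.List.Membership.DecPropositional (_≟_ {n}) using (_∈?_)

  private
    Vertex = Fin n
    Pair   = Fin n × Fin n
    Family = List (List (Fin n))

  adjacent : Vertex → Vertex → Set
  adjacent x y = adj G x y ≡ true

  -- If the joint j₁ of q lies on
  -- the path p and c₁ c₂ do not, then the edges of p and of q together
  -- form two paths; this is the only way squares enter the decomposition.

  record Rerouting (q : Square n) (p : List Vertex) : Set where
    field
      first second : List Vertex
      firstPath    : IsPathIn G first
      secondPath   : IsPathIn G second
      mult   : ∀ u v → pathMult first u v + pathMult second u v ≡ edgeMult (squareEdges q) u v + pathMult p u v
      keeps  : ∀ {x} → x ∈ p → x ∈ first ⊎ x ∈ second
      within : ∀ {x} → x ∈ first ⊎ x ∈ second → x ∈ p ⊎ x ∈ squareVerts q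

  reroute-through : ∀ {q} L R → IsSquareIn G q → IsPathIn G (L ++ j₁ q ∷ R) →
    c₁ q ∉ L ++ j₁ q ∷ R → c₂ q ∉ L ++ j₁ q ∷ R → j₂ q ∈ R → Rerouting q (L ++ j₁ q ∷ R)
  reroute-through {q@(square j₁ j₂ c₁ c₂)} L R sq path c₁∉ c₂∉ j₂∈R = record
    { first      = throughFirst q L
    ; second     = throughSecond q R
    ; firstPath  = record
      { distinct = Unique.++⁺ uL cycle-distinct L-apart
      ; nontriv  = length-≥2 L
      ; edges    = linked-join L j₁ _ linkedL (j₁c₁ ∷ c₁j₂ ∷ j₂c₂ ∷ [-]) }
    ; secondPath = record
      { distinct = unique-cons c₂-off uj₁R
      ; nontriv  = s≤s (s≤s z≤n)
      ; edges    = c₂j₁ ∷ linkedR }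
    ; mult       = through-mult q L R
    ; keeps      = through-keeps q L R
    ; within     = through-within q L R
    }
    where
    open IsSquareIn sq
    open IsPathIn path
    uL      = proj₁ (unique-split L j₁ R distinct)
    uj₁R    = proj₁ (proj₂ (unique-split L j₁ R distinct))
    apart   = proj₂ (proj₂ (unique-split L j₁ R distinct))
    linkedL = proj₁ (linked-split L j₁ R edges)
    linkedR = proj₂ (linked-split L j₁ R edges)
    cycle-distinct : Unique (j₁ ∷ c₁ ∷ j₂ ∷ c₂ ∷ [])
    cycle-distinct = (j₁≢c₁ ∷ j₁≢j₂ ∷ j₁≢c₂ ∷ []) ∷ (≢-sym j₂≢c₁ ∷ c₁≢c₂ ∷ []) ∷ (j₂≢c₂ ∷ []) ∷ [] ∷ []
    L-apart : Disjoint L (j₁ ∷ c₁ ∷ j₂ ∷ c₂ ∷ [])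
    L-apart (z∈L , here refl)                         = apart (z∈L , here refl)
    L-apart (z∈L , there (here refl))                 = c₁∉ (∈-++⁺ˡ z∈L)
    L-apart (z∈L , there (there (here refl)))         = apart (z∈L , there j₂∈R)
    L-apart (z∈L , there (there (there (here refl)))) = c₂∉ (∈-++⁺ˡ z∈L)
    c₂-off : c₂ ∉ j₁ ∷ R
    c₂-off c₂∈ = c₂∉ (∈-++⁺ʳ L c₂∈)

  reroute-around : ∀ {q} L R → IsSquareIn G q → IsPathIn G (L ++ j₁ q ∷ R) →
    c₁ q ∉ L ++ j₁ q ∷ R → c₂ q ∉ L ++ j₁ q ∷ R → j₂ q ∉ R → Rerouting q (L ++ j₁ q ∷ R)
  reroute-around {q@(square j₁ j₂ c₁ c₂)} L R sq path c₁∉ c₂∉ j₂∉R = record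
    { first      = aroundFirst q L
    ; second     = aroundSecond q R
    ; firstPath  = record
      { distinct = Unique.++⁺ uL ((j₁≢c₁ ∷ []) ∷ [] ∷ []) L-apart
      ; nontriv  = length-≥2 L
      ; edges    = linked-join L j₁ _ linkedL (j₁c₁ ∷ [-]) }
    ; secondPath = record
      { distinct = unique-cons c₁-off (unique-cons j₂-off (unique-cons c₂-off uj₁R))
      ; nontriv  = s≤s (s≤s z≤n)
      ; edges    = c₁j₂ ∷ j₂c₂ ∷ c₂j₁ ∷ linkedR }
    ; mult       = around-mult q L R
    ; keeps      = around-keeps q L R
    ; within     = around-within q L R
    }
    where
    open IsSquareIn sq
    open IsPathIn path
    uL      = proj₁ (unique-split L j₁ R distinct)
    uj₁R    = proj₁ (proj₂ (unique-split L j₁ R distinct))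
    apart   = proj₂ (proj₂ (unique-split L j₁ R distinct))
    linkedL = proj₁ (linked-split L j₁ R edges)
    linkedR = proj₂ (linked-split L j₁ R edges)
    L-apart : Disjoint L (j₁ ∷ c₁ ∷ [])
    L-apart (z∈L , here refl)         = apart (z∈L , here refl)
    L-apart (z∈L , there (here refl)) = c₁∉ (∈-++⁺ˡ z∈L)
    c₂-off : c₂ ∉ j₁ ∷ R
    c₂-off c₂∈ = c₂∉ (∈-++⁺ʳ L c₂∈)
    j₂-off : j₂ ∉ c₂ ∷ j₁ ∷ R
    j₂-off (here j₂≡c₂)         = j₂≢c₂ j₂≡c₂
    j₂-off (there (here j₂≡j₁)) = j₁≢j₂ (sym j₂≡j₁)
    j₂-off (there (there j₂∈R)) = j₂∉R j₂∈R
    c₁-off : c₁ ∉ j₂ ∷ c₂ ∷ j₁ ∷ R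
    c₁-off (here c₁≡j₂)         = j₂≢c₁ (sym c₁≡j₂)
    c₁-off (there (here c₁≡c₂)) = c₁≢c₂ c₁≡c₂
    c₁-off (there (there c₁∈))  = c₁∉ (∈-++⁺ʳ L c₁∈)

  reroute : ∀ {q} L R → IsSquareIn G q → IsPathIn G (L ++ j₁ q ∷ R) →
    c₁ q ∉ L ++ j₁ q ∷ R → c₂ q ∉ L ++ j₁ q ∷ R → Rerouting q (L ++ j₁ q ∷ R)
  reroute {q} L R sq path c₁∉ c₂∉ with j₂ q ∈? R
  ... | yes j₂∈R = reroute-through L R sq path c₁∉ c₂∉ j₂∈R
  ... | no  j₂∉R = reroute-around  L R sq path c₁∉ c₂∉ j₂∉R

  record Insertion (q : Square n) (D : Family) : Set where
    field
      paths    : Family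
      arePaths : All (IsPathIn G) paths
      size     : length paths ≡ suc (length D)
      mult     : ∀ u v → totalMult paths u v ≡ edgeMult (squareEdges q) u v + totalMult D u v
      keeps    : ∀ {x} → OnPath x D → OnPath x paths
      within   : ∀ {x} → OnPath x paths → OnPath x D ⊎ x ∈ squareVerts q

  insertAt : ∀ {q} D → All (IsPathIn G) D → IsSquareIn G q → OnPath (j₁ q) D →
    ¬ OnPath (c₁ q) D → ¬ OnPath (c₂ q) D → Insertion q D
  insertAt {q} (p ∷ D) (path ∷ paths) sq (here j₁∈p) c₁-off c₂-off
    with L , R , refl ← ∈-∃++ j₁∈p = record
    { paths    = first ∷ second ∷ D
    ; arePaths = firstPath ∷ secondPath ∷ paths
    ; size     = refl
    ; mult     = λ u v → begin
        pathMult first u v + (pathMult second u v + totalMult D u v)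
          ≡⟨ sym (+-assoc (pathMult first u v) _ _) ⟩
        (pathMult first u v + pathMult second u v) + totalMult D u v
          ≡⟨ cong (_+ totalMult D u v) (Rerouting.mult rerouted u v) ⟩
        (edgeMult (squareEdges q) u v + pathMult p u v) + totalMult D u v
          ≡⟨ +-assoc (edgeMult (squareEdges q) u v) _ _ ⟩
        edgeMult (squareEdges q) u v + (pathMult p u v + totalMult D u v) ∎
    ; keeps    = λ { (here x∈p) → [ here , there ∘ here ]′ (keeps x∈p) ; (there onD) → there (there onD) }
    ; within   = λ { (here x∈) → Data.Sum.Base.map₁ here (within (inj₁ x∈))
                   ; (there (here x∈)) → Data.Sum.Base.map₁ here (within (inj₂ x∈))
                   ; (there (there onD)) → inj₁ (there onD) }
    }
    where
    rerouted = reroute L R sq path (c₁-off ∘ here) (c₂-off ∘ here)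
    open Rerouting rerouted
  insertAt {q} (p ∷ D) (path ∷ paths) sq (there j₁-on) c₁-off c₂-off = record
    { paths    = p ∷ rest.paths
    ; arePaths = path ∷ rest.arePaths
    ; size     = cong suc rest.size
    ; mult     = λ u v → trans (cong (pathMult p u v +_) (rest.mult u v))
                               (+-comm-middle (pathMult p u v) (edgeMult (squareEdges q) u v) (totalMult D u v))
    ; keeps    = λ { (here x∈p) → here x∈p ; (there onD) → there (rest.keeps onD) }
    ; within   = λ { (here x∈p) → inj₁ (here x∈p) ; (there on) → Data.Sum.Base.map₁ there (rest.within on) }
    }
    where
    module rest = Insertion (insertAt D paths sq j₁-on (c₁-off ∘ there) (c₂-off ∘ there))
    +-comm-middle : ∀ a b c → a + (b + c) ≡ b + (a + c)
    +-comm-middle = solve-∀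

  fromSwapped : ∀ {q D} → Insertion (swapJoints q) D → Insertion q D
  fromSwapped {q} {D} ins = record
    { paths    = paths
    ; arePaths = arePaths
    ; size     = size
    ; mult     = λ u v → trans (mult u v) (cong (_+ totalMult D u v) (edgeMult-swapJoints q u v))
    ; keeps    = keeps
    ; within   = Data.Sum.Base.map₂ (squareVerts-swapJoints q) ∘ within
    }
    where open Insertion ins

  insert : ∀ {q} D → All (IsPathIn G) D → IsSquareIn G q → OnPath (j₁ q) D ⊎ OnPath (j₂ q) D →
    ¬ OnPath (c₁ q) D → ¬ OnPath (c₂ q) D → Insertion q D
  insert D paths sq (inj₁ j₁-on) c₁-off c₂-off = insertAt D paths sq j₁-on c₁-off c₂-off
  insert D paths sq (inj₂ j₂-on) c₁-off c₂-off =
    fromSwapped (insertAt D paths (swapJoints-isSquare sq) j₂-on c₂-off c₁-off)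

  -- Partial Reserved W Es: a family of
  -- edge-disjoint paths of G using exactly the edges listed in Es, with at
  -- most half as many paths as the distinct vertices W, all of which it
  -- covers; its other vertices are not Reserved (reserved vertices are
  -- kept free for squares still to come).

  record Partial (Reserved : Vertex → Set) (W : List Vertex) (Es : List Pair) : Set where
    field
      paths    : Family
      arePaths : All (IsPathIn G) paths
      realizes : ∀ u v → totalMult paths u v ≡ edgeMult Es u v
      disjoint : ∀ u v → totalMult paths u v ≤ 1
      few      : length paths + length paths ≤ length W
      distinct : Unique W
      covers   : ∀ {x} → x ∈ W → OnPath x paths
      confined : ∀ {x} → OnPath x paths → x ∈ W ⊎ ¬ Reserved x

  module _ {Reserved : Vertex → Set} {W : List Vertex} {Es : List Pair} (P : Partial Reserved W Es) where
    open Partial P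

    free : ∀ {x} → x ∉ W → Reserved x → ¬ OnPath x paths
    free x∉W res on with confined on
    ... | inj₁ x∈W    = x∉W x∈W
    ... | inj₂ ¬res   = ¬res res

    release : {Reserved′ : Vertex → Set} → (∀ {x} → Reserved′ x → Reserved x) → Partial Reserved′ W Es
    release weaker = record
      { paths = paths ; arePaths = arePaths ; realizes = realizes ; disjoint = disjoint
      ; few = few ; distinct = distinct ; covers = covers
      ; confined = Data.Sum.Base.map₂ (λ ¬res res′ → ¬res (weaker res′)) ∘ confined }

  onePath : ∀ {Reserved p} → IsPathIn G p → Partial Reserved p (pathEdges p)
  onePath {p = p} path = record
    { paths    = p ∷ []
    ; arePaths = path ∷ []
    ; realizes = λ u v → trans (+-identityʳ _) (pathMult≡edgeMult p u v)
    ; disjoint = λ u v → subst (_≤ 1) (sym (+-identityʳ _)) (pathMult≤1 p u v distinct)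
    ; few      = nontriv
    ; distinct = distinct
    ; covers   = here
    ; confined = λ { (here x∈p) → inj₁ x∈p }
    }
    where open IsPathIn path

  addPath : ∀ {Reserved W Es} → Partial Reserved W Es → ∀ L R {j} → j ∈ W →
    Unique (L ++ R) → 2 ≤ length (L ++ R) → All (_∉ W) (L ++ R) → All Reserved (L ++ R) →
    Linked adjacent (L ++ j ∷ R) → Partial Reserved ((L ++ R) ++ W) (pathEdges (L ++ j ∷ R) ++ Es)
  addPath {Reserved} {W} {Es} P L R {j} j∈W uLR long fresh reserved linked = record
    { paths    = p ∷ paths
    ; arePaths = path ∷ arePaths
    ; realizes = λ u v → trans (cong₂ _+_ (pathMult≡edgeMult p u v) (realizes u v))
                               (sym (edgeMult-++ (pathEdges p) Es u v))
    ; disjoint = λ u v → ≤1-sum (pathMult≤1 p u v uniqueP) (disjoint u v) (new-edge u v)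
    ; few      = subst (suc (length paths) + suc (length paths) ≤_) (sym (length-++ (L ++ R))) (one-more long few)
    ; distinct = Unique.++⁺ uLR distinct (λ (x∈LR , x∈W) → All.lookup fresh x∈LR x∈W)
    ; covers   = λ x∈ → [ here ∘ ∈-insert⁺ L R , there ∘ covers ]′ (∈-++⁻ (L ++ R) x∈)
    ; confined = λ { (here x∈p) → inj₁ (on-new x∈p) ; (there on) → Data.Sum.Base.map₁ (∈-++⁺ʳ (L ++ R)) (confined on) }
    }
    where
    open Partial P
    p = L ++ j ∷ R
    uniqueP : Unique p
    uniqueP = unique-insert L R j uLR (λ j∈LR → All.lookup fresh j∈LR j∈W)
    path : IsPathIn G p
    path = record
      { distinct = uniqueP
      ; nontriv  = subst (2 ≤_) (sym (length-insert L R j)) (ℕ.m≤n⇒m≤1+n long)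
      ; edges    = linked }
    on-new : ∀ {x} → x ∈ p → x ∈ (L ++ R) ++ W
    on-new x∈p = [ ∈-++⁺ˡ , (λ { refl → ∈-++⁺ʳ (L ++ R) j∈W }) ]′ (∈-insert⁻ L R x∈p)
    off : ∀ {x} → x ∈ L ++ R → ¬ OnPath x paths
    off x∈LR = free P (All.lookup fresh x∈LR) (All.lookup reserved x∈LR)
    -- an edge of the new path has an end outside W
    new-edge : ∀ u v → 1 ≤ pathMult p u v → 1 ≤ totalMult paths u v → ⊥
    new-edge u v inP = totalMult-off paths u v new-end
      where
      new-end : ¬ OnPath u paths ⊎ ¬ OnPath v paths
      new-end with ∈-insert⁻ L R (proj₁ (pathMult-ends p u v inP)) | ∈-insert⁻ L R (proj₂ (pathMult-ends p u v inP))
      ... | inj₁ u∈LR | _         = inj₁ (off u∈LR)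
      ... | inj₂ _    | inj₁ v∈LR = inj₂ (off v∈LR)
      ... | inj₂ refl | inj₂ refl = ⊥-elim (pathMult-loopless p u v uniqueP inP refl)

  record Hangs (Reserved : Vertex → Set) (W : List Vertex) (q : Square n) : Set where
    field
      isSquare  : IsSquareIn G q
      anchored  : j₁ q ∈ W ⊎ j₂ q ∈ W
      j₁-free   : ¬ Reserved (j₁ q)
      j₂-free   : ¬ Reserved (j₂ q)
      c₁-reserved : Reserved (c₁ q)
      c₂-reserved : Reserved (c₂ q)

  addSquare : ∀ {Reserved W Es q} → Partial Reserved W Es → Hangs Reserved W q →
    c₁ q ∉ W → c₂ q ∉ W → Partial Reserved (c₁ q ∷ c₂ q ∷ W) (squareEdges q ++ Es)
  addSquare {Reserved} {W} {Es} {q} P hangs c₁∉W c₂∉W = record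
    { paths    = ins.paths
    ; arePaths = ins.arePaths
    ; realizes = λ u v → trans (ins.mult u v)
                   (trans (cong (_ +_) (realizes u v)) (sym (edgeMult-++ (squareEdges q) Es u v)))
    ; disjoint = λ u v → subst (_≤ 1) (sym (ins.mult u v))
                   (≤1-sum (squareMult≤1 isSquare u v) (disjoint u v) (square-edge u v))
    ; few      = subst (λ k → k + k ≤ 2 + length W) (sym ins.size) (one-more ≤-refl few)
    ; distinct = unique-cons c₁-out (unique-cons c₂∉W distinct)
    ; covers   = λ { (here refl) → corner-on (here refl)
                   ; (there (here refl)) → corner-on (there (there (here refl)))
                   ; (there (there x∈W)) → ins.keeps (covers x∈W) }
    ; confined = [ Data.Sum.Base.map₁ (there ∘ there) ∘ confined , corner ]′ ∘ ins.within
    }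
    where
    open Partial P
    open Hangs hangs
    open IsSquareIn isSquare using (c₁≢c₂)
    c₁-off = free P c₁∉W c₁-reserved
    c₂-off = free P c₂∉W c₂-reserved
    module ins = Insertion (insert paths arePaths isSquare (Data.Sum.Base.map covers covers anchored) c₁-off c₂-off)
    c₁-out : c₁ q ∉ c₂ q ∷ W
    c₁-out (here c₁≡c₂) = c₁≢c₂ c₁≡c₂
    c₁-out (there c₁∈W) = c₁∉W c₁∈W
    -- an edge of q contains c₁ or c₂
    square-edge : ∀ u v → 1 ≤ edgeMult (squareEdges q) u v → 1 ≤ totalMult paths u v → ⊥
    square-edge u v inQ = totalMult-off paths u v
      (Data.Sum.Base.map inner-off inner-off (squareEdge-inner q u v inQ))
      where
      inner-off : ∀ {x} → x ∈ c₁ q ∷ c₂ q ∷ [] → ¬ OnPath x paths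
      inner-off (here refl)         = c₁-off
      inner-off (there (here refl)) = c₂-off
    -- the new paths carry the edges of q, hence its vertices
    corner-on : ∀ {x y} → (x , y) ∈ squareEdges q → OnPath y ins.paths
    corner-on {x} {y} e∈ = proj₂ (totalMult-ends ins.paths x y
      (subst (1 ≤_) (sym (ins.mult x y))
        (≤-trans (edgeMult-any (squareEdges q) x y (lose e∈ (sameEdge-refl x y)))
                 (ℕ.m≤m+n _ _))))
    corner : ∀ {x} → x ∈ squareVerts q → x ∈ c₁ q ∷ c₂ q ∷ W ⊎ ¬ Reserved x
    corner (here refl)                         = inj₂ j₁-free
    corner (there (here refl))                 = inj₂ j₂-free
    corner (there (there (here refl)))         = inj₁ (here refl)
    corner (there (there (there (here refl)))) = inj₁ (there (here refl))

  addSquares : ∀ {Reserved W Es} qs → All (Hangs Reserved W) qs → Unique (innerOf qs ++ W) →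
    Partial Reserved W Es → Partial Reserved (innerOf qs ++ W) (withSquares qs Es)
  addSquares []       []             _                  P = P
  addSquares {Reserved} {W} (q ∷ qs) (hangs ∷ hss) (c₁∉ ∷ c₂∉ ∷ fresh) P =
    addSquare (addSquares qs hss fresh P) hangs-higher (All¬⇒¬Any (All.tail c₁∉)) (All¬⇒¬Any c₂∉)
    where
    hangs-higher : Hangs Reserved (innerOf qs ++ W) q
    hangs-higher = record
      { isSquare = isSquare ; j₁-free = j₁-free ; j₂-free = j₂-free
      ; c₁-reserved = c₁-reserved ; c₂-reserved = c₂-reserved
      ; anchored = Data.Sum.Base.map (∈-++⁺ʳ (innerOf qs)) (∈-++⁺ʳ (innerOf qs)) anchored }
      where open Hangs hangs

  EdgesOf : List Pair → Set
  EdgesOf Es = ∀ {x y} → (x , y) ∈ Es → adjacent x y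

  pathEdges-linked : ∀ p → EdgesOf (pathEdges p) → Linked adjacent p
  pathEdges-linked []          _     = []
  pathEdges-linked (x ∷ [])    _     = [-]
  pathEdges-linked (x ∷ y ∷ p) edges = edges (here refl) ∷ pathEdges-linked (y ∷ p) (edges ∘ there)

  skeletonPartial : ∀ {col V E} → Skel col V E → EdgesOf E → Partial (λ _ → ⊤) V E
  skeletonPartial (base x0 x1 x2 x3 distinct _ _ _ _) edges =
    onePath (record { distinct = distinct ; nontriv = s≤s (s≤s z≤n)
                    ; edges = pathEdges-linked (x0 ∷ x1 ∷ x2 ∷ x3 ∷ []) edges })
  skeletonPartial (add4 sk x0 x1 x2 x3 x4 x2∈ distinct fresh _ _ _ _ _) edges =
    addPath (skeletonPartial sk (edges ∘ ∈-++⁺ʳ _)) (x0 ∷ x1 ∷ []) (x3 ∷ x4 ∷ []) x2∈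
      distinct (s≤s (s≤s z≤n)) fresh (All.universal (λ _ → tt) _)
      (pathEdges-linked (x0 ∷ x1 ∷ x2 ∷ x3 ∷ x4 ∷ []) (edges ∘ ∈-++⁺ˡ))
  skeletonPartial (add6 sk x0 x1 x2 x3 x4 x5 x6 x3∈ distinct fresh _ _ _ _ _ _ _) edges =
    addPath (skeletonPartial sk (edges ∘ ∈-++⁺ʳ _)) (x0 ∷ x1 ∷ x2 ∷ []) (x4 ∷ x5 ∷ x6 ∷ []) x3∈
      distinct (s≤s (s≤s z≤n)) fresh (All.universal (λ _ → tt) _)
      (pathEdges-linked (x0 ∷ x1 ∷ x2 ∷ x3 ∷ x4 ∷ x5 ∷ x6 ∷ []) (edges ∘ ∈-++⁺ˡ))

  -- A partial decomposition using every edge of G is a decomposition of G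
  -- into at most ⌈n/2⌉ paths: its paths are at most half of |W| ≤ n.

  complete : ∀ {Reserved W Es} → Partial Reserved W Es → (∀ u v → adjacent u v → 1 ≤ edgeMult Es u v) →
    ∃[ ps ] (IsPathDecomposition G ps × length ps ≤ ⌈ n /2⌉)
  complete {W = W} P uses = paths , (arePaths , exactlyOnce) , half
    where
    open Partial P
    exactlyOnce : ∀ u v → adjacent u v → countTrue (λ p → pathEdgeᵇ p u v) paths ≡ 1
    exactlyOnce u v uv = trans (countTrue≡totalMult paths u v (All.map IsPathIn.distinct arePaths))
      (ℕ.≤-antisym (disjoint u v) (subst (1 ≤_) (sym (realizes u v)) (uses u v uv)))
    half : length paths ≤ ⌈ n /2⌉
    half = subst (_≤ ⌈ n /2⌉) (sym (n≡⌈n+n/2⌉ (length paths)))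
             (⌈n/2⌉-mono (≤-trans few (unique-length W distinct)))

module _ {n : ℕ} where

  bunchSquare : Bunch n → Fin n × Fin n → Square n
  bunchSquare B cd = square (ja B) (jb B) (proj₁ cd) (proj₂ cd)

  bunchSquares : Bunch n → List (Square n)
  bunchSquares B = map (bunchSquare B) (squares B)

  innerOf-bunch : ∀ B → innerOf (bunchSquares B) ≡ innerVerts B
  innerOf-bunch B = go (squares B)
    where
    go : ∀ sqs → innerOf (map (bunchSquare B) sqs) ≡ concatMap (λ cd → proj₁ cd ∷ proj₂ cd ∷ []) sqs
    go []         = refl
    go (cd ∷ sqs) = cong (λ xs → proj₁ cd ∷ proj₂ cd ∷ xs) (go sqs)

  bunchEdge-squares : ∀ B u v → bunchEdgeᵇ B u v ≡ any (λ q → treeEdgeᵇ (squareEdges q) u v) (bunchSquares B)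
  bunchEdge-squares B u v = go (squares B)
    where
    go : ∀ sqs → any (λ cd → sameEdgeᵇ u v (ja B) (proj₁ cd) ∨ (sameEdgeᵇ u v (proj₁ cd) (jb B) ∨
                              (sameEdgeᵇ u v (jb B) (proj₂ cd) ∨ sameEdgeᵇ u v (proj₂ cd) (ja B)))) sqs
               ≡ any (λ q → treeEdgeᵇ (squareEdges q) u v) (map (bunchSquare B) sqs)
    go []              = refl
    go ((c , d) ∷ sqs) = cong₂ _∨_
      (cong (λ b → sameEdgeᵇ u v (ja B) c ∨ (sameEdgeᵇ u v c (jb B) ∨ (sameEdgeᵇ u v (jb B) d ∨ b)))
            (sym (∨-identityʳ (sameEdgeᵇ u v d (ja B)))))
      (go sqs)

module Hanging {n : ℕ} {H : SimpleGraph n} (hs : HangingSquareData H) where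
  open HangingSquareData hs
  open Decomposing H

  -- the inner vertices of the bunches are kept free for their squares
  Inner : Fin n → Set
  Inner x = ∃[ i ] x ∈ innerVerts (Bs i)

  edge-cases : ∀ {u v} → adjacent u v → T (treeEdgeᵇ E u v) ⊎ ∃[ i ] T (bunchEdgeᵇ (Bs i) u v)
  edge-cases {u} {v} uv =
    Data.Sum.Base.map₂ (Any.satisfied ∘ AnyP.any⁻ _ (allFin m))
      (Equivalence.to T-∨ (Equivalence.from T-≡ (trans (sym (edgesH u v)) uv)))

  tree-adjacent : ∀ {u v} → T (treeEdgeᵇ E u v) → adjacent u v
  tree-adjacent {u} {v} t = trans (edgesH u v) (Equivalence.to T-≡ (Equivalence.from T-∨ (inj₁ t)))

  bunch-adjacent : ∀ i {u v} → T (bunchEdgeᵇ (Bs i) u v) → adjacent u v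
  bunch-adjacent i {u} {v} t = trans (edgesH u v)
    (Equivalence.to T-≡ (Equivalence.from T-∨ (inj₂ (AnyP.any⁺ _ (lose (∈-allFin i) t)))))

  squareEdge-adjacent : ∀ i {q} → q ∈ bunchSquares (Bs i) → ∀ {x y} → (x , y) ∈ squareEdges q → adjacent x y
  squareEdge-adjacent i q∈ {x} {y} e∈ = bunch-adjacent i
    (subst T (sym (bunchEdge-squares (Bs i) x y)) (AnyP.any⁺ _ (lose q∈ (listed e∈))))

  -- the skeleton paths use only skeleton vertices, so inner vertices of bunches stay free
  treePartial : Partial Inner V E
  treePartial = release (skeletonPartial skel (tree-adjacent ∘ listed)) (λ _ → tt)

  inner-off-T : ∀ {i x} → x ∈ innerVerts (Bs i) → x ∉ V
  inner-off-T {i} = All.lookup (onlyJointsInT i)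

  inner-unique : ∀ i → Unique (innerVerts (Bs i))
  inner-unique i with wf i
  ... | _ ∷ _ ∷ distinct = distinct

  joint-not-inner : ∀ i j {x} → x ∈ ja (Bs i) ∷ jb (Bs i) ∷ [] → x ∉ innerVerts (Bs j)
  joint-not-inner i j x∈ x∈j with i ≟ j | wf i
  ... | yes refl | ja∉ ∷ jb∉ ∷ _ with x∈
  ...   | here refl         = All¬⇒¬Any (All.tail ja∉) x∈j
  ...   | there (here refl) = All¬⇒¬Any jb∉ x∈j
  joint-not-inner i j x∈ x∈j | no i≢j | _ =
    inner-off-T x∈j (sharedInT i j i≢j _ (joint-vertex x∈) (there (there x∈j)))
    where
    joint-vertex : ∀ {x} → x ∈ ja (Bs i) ∷ jb (Bs i) ∷ [] → x ∈ bunchVerts (Bs i)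
    joint-vertex (here x≡ja)         = here x≡ja
    joint-vertex (there (here x≡jb)) = there (here x≡jb)

  hangs : ∀ i {q} → q ∈ bunchSquares (Bs i) → Hangs Inner V q
  hangs i q∈ with ∈-map⁻ (bunchSquare (Bs i)) q∈ | wf i
  ... | cd , _ , refl | ja∉ ∷ jb∉ ∷ _ = record
    { isSquare = record
      { j₁≢j₂ = All.head ja∉
      ; j₁≢c₁ = λ { refl → All¬⇒¬Any (All.tail ja∉) c₁∈ }
      ; j₁≢c₂ = λ { refl → All¬⇒¬Any (All.tail ja∉) c₂∈ }
      ; j₂≢c₁ = λ { refl → All¬⇒¬Any jb∉ c₁∈ }
      ; j₂≢c₂ = λ { refl → All¬⇒¬Any jb∉ c₂∈ }
      ; c₁≢c₂ = innerOf-distinct (bunchSquares (Bs i)) (subst Unique (sym (innerOf-bunch (Bs i))) (inner-unique i)) q∈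
      ; j₁c₁  = squareEdge-adjacent i q∈ (here refl)
      ; c₁j₂  = squareEdge-adjacent i q∈ (there (here refl))
      ; j₂c₂  = squareEdge-adjacent i q∈ (there (there (here refl)))
      ; c₂j₁  = squareEdge-adjacent i q∈ (there (there (there (here refl)))) }
    ; anchored    = someJointInT i
    ; j₁-free     = λ (j , x∈j) → joint-not-inner i j (here refl) x∈j
    ; j₂-free     = λ (j , x∈j) → joint-not-inner i j (there (here refl)) x∈j
    ; c₁-reserved = i , c₁∈
    ; c₂-reserved = i , c₂∈
    }
    where
    c₁∈ = subst (proj₁ cd ∈_) (innerOf-bunch (Bs i)) (proj₁ (innerOf-∈ q∈))
    c₂∈ = subst (proj₂ cd ∈_) (innerOf-bunch (Bs i)) (proj₂ (innerOf-∈ q∈))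

  squaresOf : List (Fin m) → List (Square n)
  squaresOf []       = []
  squaresOf (i ∷ is) = bunchSquares (Bs i) ++ squaresOf is

  squaresOf-∈ : ∀ {i q} is → i ∈ is → q ∈ bunchSquares (Bs i) → q ∈ squaresOf is
  squaresOf-∈ (i ∷ is) (here refl) q∈ = ∈-++⁺ˡ q∈
  squaresOf-∈ (j ∷ is) (there i∈)  q∈ = ∈-++⁺ʳ (bunchSquares (Bs j)) (squaresOf-∈ is i∈ q∈)

  squaresOf-hang : ∀ is → All (Hangs Inner V) (squaresOf is)
  squaresOf-hang []       = []
  squaresOf-hang (i ∷ is) = AllP.++⁺ (All.tabulate (hangs i)) (squaresOf-hang is)

  innerOf-squaresOf : ∀ i is → innerOf (squaresOf (i ∷ is)) ≡ innerVerts (Bs i) ++ innerOf (squaresOf is)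
  innerOf-squaresOf i is = trans (innerOf-++ (bunchSquares (Bs i)) (squaresOf is))
                                 (cong (_++ innerOf (squaresOf is)) (innerOf-bunch (Bs i)))

  inner-source : ∀ is {x} → x ∈ innerOf (squaresOf is) → ∃[ j ] (j ∈ is × x ∈ innerVerts (Bs j))
  inner-source (i ∷ is) x∈ with ∈-++⁻ (innerVerts (Bs i)) (subst (_ ∈_) (innerOf-squaresOf i is) x∈)
  ... | inj₁ x∈i    = i , here refl , x∈i
  ... | inj₂ x∈rest = Product.map₂ (Product.map₁ there) (inner-source is x∈rest)

  inner-distinct : ∀ is → Unique is → Unique (innerOf (squaresOf is))
  inner-distinct []       _           = []
  inner-distinct (i ∷ is) (i∉ ∷ uis) = subst Unique (sym (innerOf-squaresOf i is))
    (Unique.++⁺ (inner-unique i) (inner-distinct is uis) apart)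
    where
    apart : Disjoint (innerVerts (Bs i)) (innerOf (squaresOf is))
    apart (x∈i , x∈rest) with inner-source is x∈rest
    ... | j , j∈ , x∈j = inner-off-T x∈i (sharedInT i j (λ { refl → All¬⇒¬Any i∉ j∈ }) _ (there (there x∈i)) (there (there x∈j)))

  allSquares : List (Square n)
  allSquares = squaresOf (allFin m)

  fresh : Unique (innerOf allSquares ++ V)
  fresh = Unique.++⁺ (inner-distinct (allFin m) (Unique.allFin⁺ m)) (Partial.distinct treePartial)
    (λ (x∈ , x∈V) → inner-off-T (proj₂ (proj₂ (inner-source (allFin m) x∈))) x∈V)

  uses : ∀ u v → adjacent u v → 1 ≤ edgeMult (withSquares allSquares E) u v
  uses u v uv = edgeMult-any _ u v (hit (edge-cases uv))
    where
    hit : T (treeEdgeᵇ E u v) ⊎ ∃[ i ] T (bunchEdgeᵇ (Bs i) u v) →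
          Any (λ e → T (sameEdgeᵇ u v (proj₁ e) (proj₂ e))) (withSquares allSquares E)
    hit (inj₁ tree) = withSquares-base allSquares E (AnyP.any⁻ _ E tree)
    hit (inj₂ (i , bunch))
      with q , q∈ , inQ ← find (AnyP.any⁻ _ (bunchSquares (Bs i)) (subst T (bunchEdge-squares (Bs i) u v) bunch))
      = withSquares-square allSquares E (squaresOf-∈ (allFin m) (∈-allFin i) q∈) (AnyP.any⁻ _ (squareEdges q) inQ)

  theorem : ∃[ ps ] (IsPathDecomposition H ps × length ps ≤ ⌈ n /2⌉)
  theorem = complete (addSquares allSquares (squaresOf-hang (allFin m)) fresh treePartial) uses

proposition1 : (n : ℕ) (H : SimpleGraph n) → IsHangingSquare H →
    ∃[ ps ] (IsPathDecomposition H ps × length ps ≤ ⌈ n /2⌉)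
proposition1 n H hs = Hanging.theorem hs
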